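{- For every term $t$, if $h(t)$ is reducible by $\to_{R_2,ACh}$, then $t=0$ or $t$ is reducible by $\to_{R_2,ACh}$.
   Context: Terms are over $\{+,h,0\}$, variables and free constants. $R_2$ is the rewrite system $x+x\to0$, $x+0\to x$, $x+(y+x)\to y$, $h(0)\to0$. $ACh$ is the theory generated by associativity and commutativity of $+$ and $h(x+y)\approx h(x)+h(y)$. $t\to_{R_2,ACh}t'$ iff there are a non-variable position $p$ of $t$, a rule $l\to r\in R_2$ and a substitution $\sigma$ with $t|_p=_{ACh}l\sigma$ and $t'=t[r\sigma]_p$. -}

module Defs where

open import Data.Nat using (ℕ)
open import Data.Product using (Σ; ∃; _,_)
open import Data.Empty using (⊥)
open import Data.Unit using (⊤; tt)

infixl 6 _⊕_
data Term : Set where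
  var  : ℕ → Term
  cst  : ℕ → Term
  𝟘    : Term
  _⊕_  : Term → Term → Term
  h    : Term → Term

Subst : Set
Subst = ℕ → Term

_[_] : Term → Subst → Term
var x   [ σ ] = σ x
cst c   [ σ ] = cst c
𝟘       [ σ ] = 𝟘
(s ⊕ t) [ σ ] = (s [ σ ]) ⊕ (t [ σ ])
h t     [ σ ] = h (t [ σ ])

infix 4 _≈ACh_
data _≈ACh_ : Term → Term → Set where
  ≈refl  : ∀ {s} → s ≈ACh s
  ≈sym   : ∀ {s t} → s ≈ACh t → t ≈ACh s
  ≈trans : ∀ {s t u} → s ≈ACh t → t ≈ACh u → s ≈ACh u
  ≈⊕     : ∀ {s s′ t t′} → s ≈ACh s′ → t ≈ACh t′ → s ⊕ t ≈ACh s′ ⊕ t′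
  ≈h     : ∀ {s s′} → s ≈ACh s′ → h s ≈ACh h s′
  assoc  : ∀ x y z → (x ⊕ y) ⊕ z ≈ACh x ⊕ (y ⊕ z)
  comm   : ∀ x y → x ⊕ y ≈ACh y ⊕ x
  hom    : ∀ x y → h (x ⊕ y) ≈ACh h x ⊕ h y

-- The rewrite system R₂ (variables x = var 0, y = var 1).
data Rule : Set where
  r-xx r-x0 r-xyx r-h0 : Rule

lhs rhs : Rule → Term
lhs r-xx  = var 0 ⊕ var 0
lhs r-x0  = var 0 ⊕ 𝟘
lhs r-xyx = var 0 ⊕ (var 1 ⊕ var 0)
lhs r-h0  = h 𝟘
rhs r-xx  = 𝟘
rhs r-x0  = var 0
rhs r-xyx = var 1
rhs r-h0  = 𝟘

NonVar : Term → Set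
NonVar (var _) = ⊥
NonVar _       = ⊤

-- One step of →_{R₂,ACh}: at some non-variable position p of t (positions
-- are represented by the congruence constructors), t|_p =_ACh lσ and the
-- subterm is replaced by rσ.
infix 4 _⟶_
data _⟶_ : Term → Term → Set where
  root : ∀ {t} (ρ : Rule) (σ : Subst) → NonVar t →
         t ≈ACh lhs ρ [ σ ] → t ⟶ rhs ρ [ σ ]
  ⊕ˡ   : ∀ {s s′ t} → s ⟶ s′ → s ⊕ t ⟶ s′ ⊕ t
  ⊕ʳ   : ∀ {s t t′} → t ⟶ t′ → s ⊕ t ⟶ s ⊕ t′
  inh  : ∀ {s s′} → s ⟶ s′ → h s ⟶ h s′

Reducible : Term → Set
Reducible t = ∃ λ t′ → t ⟶ t′

-- Modulo ACh a term is a multiset of atoms h^k(b), with b a variable, a constant or 0: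
-- associativity and commutativity flatten the sums, and h(x+y) ≈ h(x)+h(y) pushes h down
-- to the atoms.  All atoms of h(t) have level ≥ 1, so an ACh-match of h(t) against the
-- sum patterns x+x and x+(y+x) can be lowered by one level, giving a match of t itself;
-- h(t) ≈ x+0 is impossible because 0 has level 0; and h(t) ≈ h(0) forces t = 0, since
-- the ACh-class of a single atom is a singleton.
module Submission where

open import Defs
open import Data.Sum using (_⊎_; inj₁; inj₂)
open import Relation.Binary.PropositionalEquality using (_≡_; refl; sym; cong; subst)

open import Data.Empty using (⊥-elim)
open import Data.List using (List; []; _∷_; _++_; map)
open import Data.List.Membership.Propositional using (_∉_)
open import Data.List.Membership.Propositional.Properties using (∈-map⁻; ∈-++⁺ʳ)
open import Data.List.Properties using (map-++; ++-assoc; ++-conicalʳ; ∷-injectiveʳ)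
open import Data.List.Relation.Binary.Permutation.Propositional
  using (_↭_; prep; swap; trans; ↭-refl; ↭-sym; ↭-trans; ↭-reflexive)
  renaming (refl to ↭-base)
open import Data.List.Relation.Binary.Permutation.Propositional.Properties
  using (++⁺; ++-comm; map⁺; ∈-resp-↭; ¬x∷xs↭[]; ↭-singleton-inv)
open import Data.List.Relation.Unary.Any using (here)
open import Data.Nat using (ℕ; zero; suc; pred)
open import Data.Product using (_×_; _,_)
open import Data.Unit using (tt)
open import Relation.Binary.Bundles using (Setoid)
open import Relation.Nullary using (¬_)

≈ACh-setoid : Setoid _ _
≈ACh-setoid = record
  { Carrier       = Term
  ; _≈_           = _≈ACh_
  ; isEquivalence = record { refl = ≈refl ; sym = ≈sym ; trans = ≈trans }
  }

open import Relation.Binary.Reasoning.Setoid ≈ACh-setoid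

Atom : Set
Atom = ℕ × Term

atom : Atom → Term
atom (zero  , b) = b
atom (suc k , b) = h (atom (k , b))

lift lower : Atom → Atom
lift  (k , b) = suc k , b
lower (k , b) = pred k , b

flatten : Term → List Atom
flatten (s ⊕ t) = flatten s ++ flatten t
flatten (h t)   = map lift (flatten t)
flatten t       = (0 , t) ∷ []

reify : List Atom → Term
reify []          = 𝟘
reify (a ∷ [])    = atom a
reify (a ∷ b ∷ l) = atom a ⊕ reify (b ∷ l)

data NonEmpty {A : Set} : List A → Set where
  nonEmpty : ∀ {x xs} → NonEmpty (x ∷ xs)

NonEmpty-++ : ∀ {A : Set} {l : List A} m → NonEmpty l → NonEmpty (l ++ m)
NonEmpty-++ _ nonEmpty = nonEmpty

NonEmpty-map : ∀ {A B : Set} (f : A → B) {l} → NonEmpty l → NonEmpty (map f l)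
NonEmpty-map _ nonEmpty = nonEmpty

++-nonsingleton : ∀ {A : Set} {l m : List A} {c} →
                  NonEmpty l → NonEmpty m → ¬ (l ++ m ≡ c ∷ [])
++-nonsingleton {l = _ ∷ l} {m} nonEmpty nonEmpty eq
  with () ← ++-conicalʳ l m (∷-injectiveʳ eq)

flatten-nonempty : ∀ t → NonEmpty (flatten t)
flatten-nonempty (var _) = nonEmpty
flatten-nonempty (cst _) = nonEmpty
flatten-nonempty 𝟘       = nonEmpty
flatten-nonempty (s ⊕ t) = NonEmpty-++ (flatten t) (flatten-nonempty s)
flatten-nonempty (h t)   = NonEmpty-map lift (flatten-nonempty t)

≈ACh⇒↭ : ∀ {s t} → s ≈ACh t → flatten s ↭ flatten t
≈ACh⇒↭ ≈refl         = ↭-refl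
≈ACh⇒↭ (≈sym p)      = ↭-sym (≈ACh⇒↭ p)
≈ACh⇒↭ (≈trans p q)  = ↭-trans (≈ACh⇒↭ p) (≈ACh⇒↭ q)
≈ACh⇒↭ (≈⊕ p q)      = ++⁺ (≈ACh⇒↭ p) (≈ACh⇒↭ q)
≈ACh⇒↭ (≈h p)        = map⁺ lift (≈ACh⇒↭ p)
≈ACh⇒↭ (assoc x y z) = ↭-reflexive (++-assoc (flatten x) (flatten y) (flatten z))
≈ACh⇒↭ (comm x y)    = ++-comm (flatten x) (flatten y)
≈ACh⇒↭ (hom x y)     = ↭-reflexive (map-++ lift (flatten x) (flatten y))

reify-++ : ∀ {l m} → NonEmpty l → NonEmpty m → reify (l ++ m) ≈ACh reify l ⊕ reify m
reify-++ {a ∷ []}    nonEmpty nonEmpty = ≈refl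
reify-++ {a ∷ b ∷ l} nonEmpty nonEmpty =
  ≈trans (≈⊕ ≈refl (reify-++ {b ∷ l} nonEmpty nonEmpty)) (≈sym (assoc _ _ _))

reify-map-lift : ∀ {l} → NonEmpty l → reify (map lift l) ≈ACh h (reify l)
reify-map-lift {a ∷ []}    nonEmpty = ≈refl
reify-map-lift {a ∷ b ∷ l} nonEmpty =
  ≈trans (≈⊕ ≈refl (reify-map-lift {b ∷ l} nonEmpty)) (≈sym (hom _ _))

≈reify-flatten : ∀ t → t ≈ACh reify (flatten t)
≈reify-flatten (var _) = ≈refl
≈reify-flatten (cst _) = ≈refl
≈reify-flatten 𝟘       = ≈refl
≈reify-flatten (s ⊕ t) = ≈trans (≈⊕ (≈reify-flatten s) (≈reify-flatten t))
  (≈sym (reify-++ (flatten-nonempty s) (flatten-nonempty t)))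
≈reify-flatten (h t)   = ≈trans (≈h (≈reify-flatten t))
  (≈sym (reify-map-lift (flatten-nonempty t)))

reify-∷-cong : ∀ a {l m} → l ↭ m → reify l ≈ACh reify m → reify (a ∷ l) ≈ACh reify (a ∷ m)
reify-∷-cong a {[]}    {[]}    _ _  = ≈refl
reify-∷-cong a {[]}    {_ ∷ _} p _  = ⊥-elim (¬x∷xs↭[] (↭-sym p))
reify-∷-cong a {_ ∷ _} {[]}    p _  = ⊥-elim (¬x∷xs↭[] p)
reify-∷-cong a {_ ∷ _} {_ ∷ _} _ eq = ≈⊕ ≈refl eq

reify-swap : ∀ a b l → reify (a ∷ b ∷ l) ≈ACh reify (b ∷ a ∷ l)
reify-swap a b []      = comm _ _
reify-swap a b (c ∷ l) =
  ≈trans (≈sym (assoc _ _ _)) (≈trans (≈⊕ (comm _ _) ≈refl) (assoc _ _ _))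

reify-resp-↭ : ∀ {l m} → l ↭ m → reify l ≈ACh reify m
reify-resp-↭ ↭-base       = ≈refl
reify-resp-↭ (prep a p)   = reify-∷-cong a p (reify-resp-↭ p)
reify-resp-↭ (swap {xs = l} a b p) = ≈trans (reify-swap a b l)
  (reify-∷-cong b (prep a p) (reify-∷-cong a p (reify-resp-↭ p)))
reify-resp-↭ (trans p q)  = ≈trans (reify-resp-↭ p) (reify-resp-↭ q)

flatten-singleton : ∀ t {a} → flatten t ≡ a ∷ [] → t ≡ atom a
flatten-singleton (var _) refl = refl
flatten-singleton (cst _) refl = refl
flatten-singleton 𝟘       refl = refl
flatten-singleton (s ⊕ t) eq   =
  ⊥-elim (++-nonsingleton (flatten-nonempty s) (flatten-nonempty t) eq)
flatten-singleton (h t)   eq with flatten t in ft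
... | _ ∷ [] with refl ← eq = cong h (flatten-singleton t ft)

≈-singleton⇒≡atom : ∀ {t u a} → flatten u ≡ a ∷ [] → t ≈ACh u → t ≡ atom a
≈-singleton⇒≡atom fu eq =
  flatten-singleton _ (↭-singleton-inv (↭-trans (≈ACh⇒↭ eq) (↭-reflexive fu)))

NonVar-resp-≈ : ∀ {t u} → t ≈ACh u → NonVar u → NonVar t
NonVar-resp-≈ {var _} eq nv = subst NonVar (≈-singleton⇒≡atom refl (≈sym eq)) nv
NonVar-resp-≈ {cst _} _  _  = tt
NonVar-resp-≈ {𝟘}     _  _  = tt
NonVar-resp-≈ {_ ⊕ _} _  _  = tt
NonVar-resp-≈ {h _}   _  _  = tt

level-0-∉-map-lift : ∀ {b} l → (0 , b) ∉ map lift l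
level-0-∉-map-lift l m with ∈-map⁻ lift m
... | _ , _ , ()

h≉⊕𝟘 : ∀ {t u} → ¬ (h t ≈ACh u ⊕ 𝟘)
h≉⊕𝟘 {t} {u} eq =
  level-0-∉-map-lift (flatten t) (∈-resp-↭ (↭-sym (≈ACh⇒↭ eq)) (∈-++⁺ʳ (flatten u) (here refl)))

-- An inverse of h up to ACh (h-injective); atoms of level 0 stay put, as pred 0 = 0.
_↓ : Term → Term
t ↓ = reify (map lower (flatten t))

map-lower-lift : ∀ l → map lower (map lift l) ≡ l
map-lower-lift []      = refl
map-lower-lift (a ∷ l) = cong (a ∷_) (map-lower-lift l)

h-injective : ∀ {t u} → h t ≈ACh u → t ≈ACh u ↓
h-injective {t} {u} eq = begin
  t                                  ≈⟨ ≈reify-flatten t ⟩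
  reify (flatten t)                  ≡⟨ cong reify (sym (map-lower-lift (flatten t))) ⟩
  reify (map lower (flatten (h t)))  ≈⟨ reify-resp-↭ (map⁺ lower (≈ACh⇒↭ eq)) ⟩
  u ↓                                ∎

↓-⊕ : ∀ u v → (u ⊕ v) ↓ ≈ACh u ↓ ⊕ v ↓
↓-⊕ u v = begin
  reify (map lower (flatten u ++ flatten v))
    ≡⟨ cong reify (map-++ lower (flatten u) (flatten v)) ⟩
  reify (map lower (flatten u) ++ map lower (flatten v))
    ≈⟨ reify-++ (lowered u) (lowered v) ⟩
  u ↓ ⊕ v ↓ ∎
  where
  lowered : ∀ t → NonEmpty (map lower (flatten t))
  lowered t = NonEmpty-map lower (flatten-nonempty t)

data SumPattern : Term → Set where
  var : ∀ x → SumPattern (var x)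
  _⊕_ : ∀ {p q} → SumPattern p → SumPattern q → SumPattern (p ⊕ q)

_↓ˢ : Subst → Subst
(σ ↓ˢ) x = σ x ↓

↓-[] : ∀ {p} σ → SumPattern p → (p [ σ ]) ↓ ≈ACh p [ σ ↓ˢ ]
↓-[] σ (var x)             = ≈refl
↓-[] σ (_⊕_ {p} {q} sp sq) = ≈trans (↓-⊕ (p [ σ ]) (q [ σ ])) (≈⊕ (↓-[] σ sp) (↓-[] σ sq))

h-sum-redex⇒Reducible : ∀ {t} ρ σ → SumPattern (lhs ρ) → NonVar (lhs ρ [ σ ↓ˢ ]) →
                        h t ≈ACh lhs ρ [ σ ] → Reducible t
h-sum-redex⇒Reducible {t} ρ σ p nv eq = rhs ρ [ σ ↓ˢ ] , root ρ (σ ↓ˢ) (NonVar-resp-≈ t≈ nv) t≈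
  where
  t≈ : t ≈ACh lhs ρ [ σ ↓ˢ ]
  t≈ = ≈trans (h-injective eq) (↓-[] σ p)

mainTheorem15 : ∀ (t : Term) → Reducible (h t) → t ≡ 𝟘 ⊎ Reducible t
mainTheorem15 t (_ , inh step)          = inj₂ (_ , step)
mainTheorem15 t (_ , root r-xx  σ _ eq) =
  inj₂ (h-sum-redex⇒Reducible r-xx σ (var 0 ⊕ var 0) tt eq)
mainTheorem15 t (_ , root r-xyx σ _ eq) =
  inj₂ (h-sum-redex⇒Reducible r-xyx σ (var 0 ⊕ (var 1 ⊕ var 0)) tt eq)
mainTheorem15 t (_ , root r-x0  σ _ eq) = ⊥-elim (h≉⊕𝟘 eq)
mainTheorem15 t (_ , root r-h0  σ _ eq) = inj₁ (≈-singleton⇒≡atom refl (h-injective eq))
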